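{- Let $T\in[1..\sigma]^{n-1}\#$ and let $\overline{T}$ be its reverse. There is a bijection between $\mathcal{E}^{r}_T$ and the set of all explicit Weiner links leaving nodes of $\mathsf{ST}_{\overline{T}}$ that correspond to maximal repeats of $T$. There is a bijection between $\mathcal{F}^{r}_T$ and the set of all implicit Weiner links leaving nodes of $\mathsf{ST}_{\overline{T}}$ that correspond to maximal repeats of $T$. Here a node $v'$ of $\mathsf{ST}_{\overline{T}}$ corresponds to a maximal repeat $W$ of $T$ if $\ell(v')=\overline{W}$.
   Context: Alphabet $[1..\sigma]$, separator $\#=0\notin[1..\sigma]$, with order $0<1<\dots<\sigma$. $T=T[1..n]\in[1..\sigma]^{n-1}\#$, so $\#$ occurs exactly once, at position $n$; $\overline{X}$ denotes the reverse of a string $X$. For a string $W$, $\mathcal{P}_T(W)$ is the set of starting positions of occurrences of $W$ in the circular version of $T$. $\Sigma^{\ell}_T(W)=\{a\in[0..\sigma]:\mathcal{P}_T(aW)\neq\emptyset\}$ and $\Sigma^{r}_T(W)=\{b\in[0..\sigma]:\mathcal{P}_T(Wb)\neq\emptyset\}$. $W$ is a repeat if $|\mathcal{P}_T(W)|>1$; a repeat is right-maximal if $|\Sigma^{r}_T(W)|>1$ and left-maximal if $|\Sigma^{\ell}_T(W)|>1$; a maximal repeat is a repeat that is both left- and right-maximal; $\mathcal{M}_T$ is the set of maximal repeats of $T$. $\mathsf{ST}_T$ is the suffix tree of $T$; $\ell(v)$ denotes the string spelled from the root to node $v$ and $\ell(u,v)$ the label of edge $(u,v)$; internal nodes of $\mathsf{ST}_T$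 are labeled exactly by the right-maximal substrings of $T$. $\mathcal{E}^{r}_T$ is the set of edges $(v,w)$ of $\mathsf{ST}_T$ with both $\ell(v)$ and $\ell(w)$ in $\mathcal{M}_T$; $\mathcal{F}^{r}_T$ is the set of edges $(v,w)$ of $\mathsf{ST}_T$ with $\ell(v)\in\mathcal{M}_T$ and $\ell(w)\notin\mathcal{M}_T$. Weiner links in a suffix tree $\mathsf{ST}_X$: for an internal node $v$ and a character $a$ such that $a\ell(v)$ occurs in $X$, there is a Weiner link from $v$ labeled $a$; it is explicit if $a\ell(v)$ is the label of an internal node of $\mathsf{ST}_X$ (explicit Weiner links are the reverses of suffix links), and implicit otherwise (i.e. $a\ell(v)$ ends in the middle of an edge). -}

module Defs where

open import Data.Nat using (ℕ; zero; suc; _+_; _≡ᵇ_; _<ᵇ_; _%_; _≤_)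
open import Data.Bool using (Bool; true; false; _∧_; _∨_; not; T)
open import Data.List using (List; []; _∷_; _++_; length; filter; upTo; take; drop; map; reverse; [_])
open import Data.Bool.ListAction using (any; all)
open import Data.Product using (Σ; _×_)
open import Relation.Nullary.Decidable using (does)
open import Data.Bool.Properties using (T?)

-- Strings over the alphabet [0..σ] are lists of naturals; the separator # is 0.
String : Set
String = List ℕ

eqStr : String → String → Bool
eqStr [] [] = true
eqStr [] (_ ∷ _) = false
eqStr (_ ∷ _) [] = false
eqStr (x ∷ xs) (y ∷ ys) = (x ≡ᵇ y) ∧ eqStr xs ys

-- k-th character (0-based) of a list, default 0 when out of range
nth : String → ℕ → ℕ
nth [] _ = 0
nth (x ∷ xs) zero = x
nth (x ∷ xs) (suc k) = nth xs k

circ : String → ℕ → ℕ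
circ [] k = 0
circ X@(x ∷ xs) k = nth X (k % suc (length xs))

matchAt : String → String → ℕ → Bool
matchAt X [] i = true
matchAt X (c ∷ W) i = (c ≡ᵇ circ X i) ∧ matchAt X W (suc i)

occ : String → String → List ℕ
occ X W = filter (λ i → T? (matchAt X W i)) (upTo (length X))

occurs : String → String → Bool
occurs X W = 0 <ᵇ length (occ X W)

leftExt : ℕ → String → String → List ℕ
leftExt σ X W = filter (λ a → T? (occurs X (a ∷ W))) (upTo (suc σ))

rightExt : ℕ → String → String → List ℕ
rightExt σ X W = filter (λ b → T? (occurs X (W ++ [ b ]))) (upTo (suc σ))

isRepeat : String → String → Bool
isRepeat X W = 1 <ᵇ length (occ X W)

rightMaximal : ℕ → String → String → Bool
rightMaximal σ X W = 1 <ᵇ length (rightExt σ X W)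

leftMaximal : ℕ → String → String → Bool
leftMaximal σ X W = 1 <ᵇ length (leftExt σ X W)

maximalRepeat : ℕ → String → String → Bool
maximalRepeat σ X W = isRepeat X W ∧ leftMaximal σ X W ∧ rightMaximal σ X W

-- Suffix tree ST_X, nodes identified with their labels ℓ(v).
-- Internal nodes: exactly the right-maximal substrings of X.
-- Leaves: the suffixes X[i..|X|] of X.

isInternal : ℕ → String → String → Bool
isInternal = rightMaximal

isLeaf : String → String → Bool
isLeaf X W = any (λ i → eqStr W (drop i X)) (upTo (length X))

isNode : ℕ → String → String → Bool
isNode σ X W = isInternal σ X W ∨ isLeaf X W

properPrefix : String → String → Bool
properPrefix V W = (length V <ᵇ length W) ∧ eqStr (take (length V) W) V

isEdge : ℕ → String → String × String → Bool
isEdge σ X (V Data.Product., W) =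
  isInternal σ X V ∧ isNode σ X W ∧ properPrefix V W ∧
  all (λ k → not ((length V <ᵇ k) ∧ isInternal σ X (take k W))) (upTo (length W))

isWeinerLink : ℕ → String → String × ℕ → Bool
isWeinerLink σ X (V Data.Product., a) = isInternal σ X V ∧ occurs X (a ∷ V)

isExplicitWL : ℕ → String → String × ℕ → Bool
isExplicitWL σ X (V Data.Product., a) = isWeinerLink σ X (V Data.Product., a) ∧ isInternal σ X (a ∷ V)

isImplicitWL : ℕ → String → String × ℕ → Bool
isImplicitWL σ X (V Data.Product., a) = isWeinerLink σ X (V Data.Product., a) ∧ not (isInternal σ X (a ∷ V))

Er : ℕ → String → Set
Er σ t = Σ (String × String) (λ e → T (isEdge σ t e ∧ maximalRepeat σ t (Data.Product.proj₁ e) ∧ maximalRepeat σ t (Data.Product.proj₂ e)))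

Fr : ℕ → String → Set
Fr σ t = Σ (String × String) (λ e → T (isEdge σ t e ∧ maximalRepeat σ t (Data.Product.proj₁ e) ∧ not (maximalRepeat σ t (Data.Product.proj₂ e))))

ExplWLrev : ℕ → String → Set
ExplWLrev σ t = Σ (String × ℕ) (λ l → T (isExplicitWL σ (reverse t) l ∧ maximalRepeat σ t (reverse (Data.Product.proj₁ l))))

ImplWLrev : ℕ → String → Set
ImplWLrev σ t = Σ (String × ℕ) (λ l → T (isImplicitWL σ (reverse t) l ∧ maximalRepeat σ t (reverse (Data.Product.proj₁ l))))

module Submission where

-- Write X = T and Y = reverse T.  The map (ℓ(v), ℓ(w)) ↦ (reverse ℓ(v), b), where b is
-- the first character of the edge label ℓ(v,w), sends edges of ST_X leaving a maximal
-- repeat V to Weiner links of ST_Y leaving reverse V, and both bijections of the theorem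
-- are restrictions of it.

open import Defs
open import Data.Nat using (ℕ; zero; suc; _+_; _*_; _∸_; _≤_; _<_; z≤n; s≤s; s≤s⁻¹; _≡ᵇ_; _<ᵇ_; _%_; NonZero)
open import Data.Nat.Properties
open import Data.Nat.DivMod using (%-distribˡ-+; [m+kn]%n≡m%n; [m+n]%n≡m%n; m<n⇒m%n≡m; m%n%n≡m%n; m%n<n)
open import Data.Bool using (Bool; true; false; _∧_; _∨_; not; T)
open import Data.Bool.Properties using (T?; T-irrelevant; T-∧; T-∨)
open import Data.List using (List; []; _∷_; _++_; length; filter; upTo; take; drop; reverse; [_])
open import Data.List.Properties
  using (length-++; reverse-++; reverse-involutive; reverse-injective; length-take; length-drop;
         take++drop≡id; drop-drop; ++-assoc; ++-identityʳ; take-all; unfold-reverse)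
open import Data.List.Membership.Propositional using (_∈_; find; lose)
open import Data.List.Membership.Propositional.Properties using (∈-filter⁺; ∈-filter⁻; ∈-upTo⁺; ∈-upTo⁻)
open import Data.List.Relation.Unary.Any using (here; there)
import Data.List.Relation.Unary.Any.Properties as AnyP
open import Data.List.Relation.Unary.All as All using (All; _∷_)
import Data.List.Relation.Unary.All.Properties as AllP
open import Data.List.Relation.Unary.AllPairs using (_∷_)
open import Data.List.Relation.Unary.Unique.Propositional using (Unique)
import Data.List.Relation.Unary.Unique.Propositional.Properties as UniqueP
open import Data.Product using (Σ; _×_; _,_; proj₁; proj₂; ∃)
open import Data.Sum using (_⊎_; inj₁; inj₂)
open import Data.Empty using (⊥; ⊥-elim)
open import Function.Base using (id)
open import Function.Bundles using (_⤖_; mk⤖; Equivalence)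
open import Relation.Nullary using (¬_; yes; no)
open import Relation.Binary.PropositionalEquality hiding ([_])

∧-intro : ∀ {a b} → T a → T b → T (a ∧ b)
∧-intro p q = Equivalence.from T-∧ (p , q)

∧-fst : ∀ {a b} → T (a ∧ b) → T a
∧-fst {a} p = proj₁ (Equivalence.to (T-∧ {a}) p)

∧-snd : ∀ {a b} → T (a ∧ b) → T b
∧-snd {a} p = proj₂ (Equivalence.to (T-∧ {a}) p)

∨-elim : ∀ {a b} → T (a ∨ b) → T a ⊎ T b
∨-elim {a} = Equivalence.to (T-∨ {a})

∨-inl : ∀ {a b} → T a → T (a ∨ b)
∨-inl p = Equivalence.from T-∨ (inj₁ p)

∨-inr : ∀ {a b} → T b → T (a ∨ b)
∨-inr {a} p = Equivalence.from (T-∨ {a}) (inj₂ p)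

not-intro : ∀ {a} → ¬ T a → T (not a)
not-intro {false} _ = _
not-intro {true} f = f _

not-elim : ∀ {a} → T (not a) → ¬ T a
not-elim {false} _ ()

T-ext : ∀ {a b} → (T a → T b) → (T b → T a) → a ≡ b
T-ext {false} {false} _ _ = refl
T-ext {false} {true} _ g = ⊥-elim (g _)
T-ext {true} {false} f _ = ⊥-elim (f _)
T-ext {true} {true} _ _ = refl

refine-≡ : ∀ {A : Set} (P : A → Bool) {u v : Σ A (λ x → T (P x))} → proj₁ u ≡ proj₁ v → u ≡ v
refine-≡ P {a , p} {.a , q} refl = cong (a ,_) (T-irrelevant p q)

-- Counting the elements of a list satisfying a Boolean predicate; all the cardinalities of
-- Defs (|𝒫|, |Σ^ℓ|, |Σ^r|) are of this form, and only "≥ 1" and "≥ 2" are ever asked.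

count : (ℕ → Bool) → List ℕ → ℕ
count f xs = length (filter (λ i → T? (f i)) xs)

count-pos : ∀ f xs {x} → x ∈ xs → T (f x) → T (0 <ᵇ count f xs)
count-pos f xs x∈ fx with filter (λ i → T? (f i)) xs | ∈-filter⁺ (λ i → T? (f i)) x∈ fx
... | _ ∷ _ | _ = _

count-pos⁻ : ∀ f xs → T (0 <ᵇ count f xs) → ∃ λ x → x ∈ xs × T (f x)
count-pos⁻ f xs p with filter (λ i → T? (f i)) xs in eq
... | y ∷ _ = y , ∈-filter⁻ (λ i → T? (f i)) {xs = xs} (subst (y ∈_) (sym eq) (here refl))

count-two : ∀ f xs {x y} → x ∈ xs → y ∈ xs → ¬ x ≡ y → T (f x) → T (f y) → T (1 <ᵇ count f xs)
count-two f xs x∈ y∈ x≢y fx fy =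
  two-members _ (∈-filter⁺ (λ i → T? (f i)) x∈ fx) (∈-filter⁺ (λ i → T? (f i)) y∈ fy) x≢y
  where
  two-members : ∀ (l : List ℕ) {x y} → x ∈ l → y ∈ l → ¬ x ≡ y → T (1 <ᵇ length l)
  two-members (_ ∷ _ ∷ _) _ _ _ = _
  two-members (_ ∷ []) (here refl) (here refl) ne = ne refl

count-two⁻ : ∀ f xs → Unique xs → T (1 <ᵇ count f xs) →
  ∃ λ x → ∃ λ y → ¬ x ≡ y × T (f x) × T (f y)
count-two⁻ f xs u p with filter (λ i → T? (f i)) xs in eq | UniqueP.filter⁺ (λ i → T? (f i)) u
... | x ∷ y ∷ _ | (x≢y ∷ _) ∷ _ =
  x , y , x≢y , proj₂ (∈-filter⁻ (λ i → T? (f i)) {xs = xs} (subst (x ∈_) (sym eq) (here refl)))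
              , proj₂ (∈-filter⁻ (λ i → T? (f i)) {xs = xs} (subst (y ∈_) (sym eq) (there (here refl))))

count-cong : ∀ (f g : ℕ → Bool) → (∀ a → f a ≡ g a) → ∀ l → count f l ≡ count g l
count-cong f g e [] = refl
count-cong f g e (a ∷ l) with f a | g a | e a
... | true | true | refl = cong suc (count-cong f g e l)
... | false | false | refl = count-cong f g e l

least : (P : ℕ → Bool) → ∀ d lo → T (P (lo + d)) →
  ∃ λ k → lo ≤ k × T (P k) × (∀ k' → lo ≤ k' → k' < k → ¬ T (P k'))
least P zero lo p = lo , ≤-refl , subst (λ z → T (P z)) (+-identityʳ lo) p , λ _ a b → ⊥-elim (<-irrefl refl (≤-<-trans a b))
least P (suc d) lo p with T? (P lo)
... | yes pl = lo , ≤-refl , pl , λ _ a b → ⊥-elim (<-irrefl refl (≤-<-trans a b))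
... | no ¬pl with least P d (suc lo) (subst (λ z → T (P z)) (+-suc lo d) p)
... | k , sl≤k , pk , below = k , ≤-trans (n≤1+n lo) sl≤k , pk , below' where
  below' : ∀ k' → lo ≤ k' → k' < k → ¬ T (P k')
  below' k' lo≤k' k'<k with m≤n⇒m<n∨m≡n lo≤k'
  ... | inj₁ lo<k' = below k' lo<k' k'<k
  ... | inj₂ refl = ¬pl

eqStr⁻ : ∀ V W → T (eqStr V W) → V ≡ W
eqStr⁻ [] [] _ = refl
eqStr⁻ (x ∷ V) (y ∷ W) p = cong₂ _∷_ (≡ᵇ⇒≡ x y (∧-fst p)) (eqStr⁻ V W (∧-snd {x ≡ᵇ y} p))

eqStr-refl : ∀ V → T (eqStr V V)
eqStr-refl [] = _
eqStr-refl (x ∷ V) = ∧-intro (≡⇒≡ᵇ x x refl) (eqStr-refl V)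

nth-++ˡ : ∀ A B j → j < length A → nth (A ++ B) j ≡ nth A j
nth-++ˡ (a ∷ A) B zero _ = refl
nth-++ˡ (a ∷ A) B (suc j) (s≤s p) = nth-++ˡ A B j p

nth-++ʳ : ∀ A B j → nth (A ++ B) (length A + j) ≡ nth B j
nth-++ʳ [] B j = refl
nth-++ʳ (a ∷ A) B j = nth-++ʳ A B j

nth-take : ∀ k W j → j < k → nth (take k W) j ≡ nth W j
nth-take (suc k) [] j _ = refl
nth-take (suc k) (w ∷ W) zero _ = refl
nth-take (suc k) (w ∷ W) (suc j) (s≤s p) = nth-take k W j p

nth-drop : ∀ i W j → nth (drop i W) j ≡ nth W (i + j)
nth-drop zero W j = refl
nth-drop (suc i) [] j = refl
nth-drop (suc i) (w ∷ W) j = nth-drop i W j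

nth-ext : ∀ (A B : List ℕ) → length A ≡ length B → (∀ j → j < length A → nth A j ≡ nth B j) → A ≡ B
nth-ext [] [] _ _ = refl
nth-ext (a ∷ A) (b ∷ B) eq h = cong₂ _∷_ (h 0 (s≤s z≤n)) (nth-ext A B (suc-injective eq) (λ j p → h (suc j) (s≤s p)))

length-take≤ : ∀ k (W : List ℕ) → k ≤ length W → length (take k W) ≡ k
length-take≤ k W k≤ = trans (length-take k W) (m≤n⇒m⊓n≡m k≤)

take-suc-nth : ∀ k (W : List ℕ) → k < length W → take (suc k) W ≡ take k W ++ [ nth W k ]
take-suc-nth zero (w ∷ W) _ = refl
take-suc-nth (suc k) (w ∷ W) (s≤s p) = cong (w ∷_) (take-suc-nth k W p)

take-whole : ∀ (W : List ℕ) → take (length W) W ≡ W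
take-whole W = take-all (length W) W ≤-refl

lcp : ∀ (W W' : List ℕ) → ∃ λ k → take k W ≡ take k W' ×
  (k ≡ length W × k ≤ length W' ⊎ k ≡ length W' × k ≤ length W ⊎ (k < length W × k < length W' × ¬ nth W k ≡ nth W' k))
lcp [] W' = 0 , refl , inj₁ (refl , z≤n)
lcp (a ∷ W) [] = 0 , refl , inj₂ (inj₁ (refl , z≤n))
lcp (a ∷ W) (b ∷ W') with a ≟ b
... | no ne = 0 , refl , inj₂ (inj₂ (s≤s z≤n , s≤s z≤n , ne))
... | yes refl with lcp W W'
... | k , e , inj₁ (e1 , l) = suc k , cong (a ∷_) e , inj₁ (cong suc e1 , s≤s l)
... | k , e , inj₂ (inj₁ (e1 , l)) = suc k , cong (a ∷_) e , inj₂ (inj₁ (cong suc e1 , s≤s l))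
... | k , e , inj₂ (inj₂ (l1 , l2 , ne)) = suc k , cong (a ∷_) e , inj₂ (inj₂ (s≤s l1 , s≤s l2 , ne))

%-congˡ-+ : ∀ n .{{_ : NonZero n}} a b c → a % n ≡ b % n → (a + c) % n ≡ (b + c) % n
%-congˡ-+ n a b c e = begin
  (a + c) % n           ≡⟨ %-distribˡ-+ a c n ⟩
  (a % n + c % n) % n   ≡⟨ cong (λ z → (z + c % n) % n) e ⟩
  (b % n + c % n) % n   ≡⟨ %-distribˡ-+ b c n ⟨
  (b + c) % n           ∎ where open ≡-Reasoning

%-cancelˡ-+ : ∀ m a b c → (a + c) % suc m ≡ (b + c) % suc m → a % suc m ≡ b % suc m
%-cancelˡ-+ m a b c e = begin
  a % suc m                 ≡⟨ [m+kn]%n≡m%n a c (suc m) ⟨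
  (a + c * suc m) % suc m   ≡⟨ cong (_% suc m) (unroll a) ⟩
  (a + c + c * m) % suc m   ≡⟨ %-congˡ-+ (suc m) (a + c) (b + c) (c * m) e ⟩
  (b + c + c * m) % suc m   ≡⟨ cong (_% suc m) (unroll b) ⟨
  (b + c * suc m) % suc m   ≡⟨ [m+kn]%n≡m%n b c (suc m) ⟩
  b % suc m                 ∎ where
  open ≡-Reasoning
  unroll : ∀ a → a + c * suc m ≡ a + c + c * m
  unroll a = trans (cong (a +_) (*-suc c m)) (sym (+-assoc a c (c * m)))

module Circular (x : ℕ) (xs : List ℕ) where
  X : List ℕ
  X = x ∷ xs

  m : ℕ
  m = length xs

  n : ℕ
  n = suc m

  circ-mod : ∀ a b → a % n ≡ b % n → circ X a ≡ circ X b
  circ-mod a b e = cong (nth X) e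

  circ-lt : ∀ k → k < n → circ X k ≡ nth X k
  circ-lt k p = cong (nth X) (m<n⇒m%n≡m p)

  Occ : List ℕ → ℕ → Set
  Occ W i = ∀ j → j < length W → nth W j ≡ circ X (i + j)

  Occ-cons : ∀ c W i → c ≡ circ X i → Occ W (suc i) → Occ (c ∷ W) i
  Occ-cons c W i e o zero _ = trans e (cong (circ X) (sym (+-identityʳ i)))
  Occ-cons c W i e o (suc j) (s≤s q) = trans (o j q) (cong (circ X) (sym (+-suc i j)))

  Occ-head : ∀ c W i → Occ (c ∷ W) i → c ≡ circ X i
  Occ-head c W i o = trans (o 0 (s≤s z≤n)) (cong (circ X) (+-identityʳ i))

  Occ-tail : ∀ c W i → Occ (c ∷ W) i → Occ W (suc i)
  Occ-tail c W i o j q = trans (o (suc j) (s≤s q)) (cong (circ X) (+-suc i j))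

  match⇒Occ : ∀ W i → T (matchAt X W i) → Occ W i
  match⇒Occ (c ∷ W) i p = Occ-cons c W i (≡ᵇ⇒≡ c (circ X i) (∧-fst p)) (match⇒Occ W (suc i) (∧-snd {c ≡ᵇ circ X i} p))

  Occ⇒match : ∀ W i → Occ W i → T (matchAt X W i)
  Occ⇒match [] i o = _
  Occ⇒match (c ∷ W) i o =
    ∧-intro (≡⇒≡ᵇ c (circ X i) (Occ-head c W i o)) (Occ⇒match W (suc i) (Occ-tail c W i o))

  Occ-mod : ∀ W i → Occ W i → Occ W (i % n)
  Occ-mod W i o j q = trans (o j q) (circ-mod (i + j) (i % n + j) (%-congˡ-+ n i (i % n) j (sym (m%n%n≡m%n i n))))

  Occ⇒occurs : ∀ W i → Occ W i → T (occurs X W)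
  Occ⇒occurs W i o = count-pos (matchAt X W) (upTo n) (∈-upTo⁺ (m%n<n i n)) (Occ⇒match W (i % n) (Occ-mod W i o))

  occurs⇒Occ : ∀ W → T (occurs X W) → ∃ λ i → i < n × Occ W i
  occurs⇒Occ W p with count-pos⁻ (matchAt X W) (upTo n) p
  ... | i , i∈ , q = i , ∈-upTo⁻ i∈ , match⇒Occ W i q

  Occ-++ˡ : ∀ A B i → Occ (A ++ B) i → Occ A i
  Occ-++ˡ A B i o j q =
    trans (sym (nth-++ˡ A B j q)) (o j (≤-trans q (subst (length A ≤_) (sym (length-++ A)) (m≤m+n _ _))))

  Occ-++ʳ : ∀ A B i → Occ (A ++ B) i → Occ B (i + length A)
  Occ-++ʳ A B i o j q = trans (sym (nth-++ʳ A B j))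
     (trans (o (length A + j) (subst (length A + j <_) (sym (length-++ A)) (+-monoʳ-< (length A) q)))
            (cong (circ X) (sym (+-assoc i (length A) j))))

  Occ-++ : ∀ A B i → Occ A i → Occ B (i + length A) → Occ (A ++ B) i
  Occ-++ A B i oa ob j q with j <? length A
  ... | yes p = trans (nth-++ˡ A B j p) (oa j p)
  ... | no ¬p = begin
      nth (A ++ B) j                ≡⟨ cong (nth (A ++ B)) e ⟨
      nth (A ++ B) (length A + k)   ≡⟨ nth-++ʳ A B k ⟩
      nth B k                       ≡⟨ ob k k< ⟩
      circ X (i + length A + k)     ≡⟨ cong (circ X) (trans (+-assoc i (length A) k) (cong (i +_) e)) ⟩
      circ X (i + j)                ∎ where
        open ≡-Reasoning
        k = j ∸ length A
        e : length A + k ≡ j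
        e = m+[n∸m]≡n (≮⇒≥ ¬p)
        k< : k < length B
        k< = +-cancelˡ-< (length A) _ _ (subst₂ _<_ (sym e) (length-++ A) q)

  Occ-take : ∀ k W i → Occ W i → Occ (take k W) i
  Occ-take k W i o j q =
    trans (nth-take k W j (≤-trans q (subst (_≤ k) (sym (length-take k W)) (m⊓n≤m k _))))
          (o j (≤-trans q (subst (_≤ length W) (sym (length-take k W)) (m⊓n≤n k _))))

  prefix-next-occurs : ∀ W q k → Occ W q → k < length W → T (occurs X (take k W ++ [ nth W k ]))
  prefix-next-occurs W q k o k< =
    Occ⇒occurs (take k W ++ [ nth W k ]) q (subst (λ z → Occ z q) (take-suc-nth k W k<) (Occ-take (suc k) W q o))

  Occ-snoc : ∀ W d i → Occ W i → d ≡ circ X (i + length W) → Occ (W ++ [ d ]) i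
  Occ-snoc W d i o e = Occ-++ W [ d ] i o (Occ-cons d [] (i + length W) e (λ _ ()))

  Occ-last : ∀ W b i → Occ (W ++ [ b ]) i → b ≡ circ X (i + length W)
  Occ-last W b i o = Occ-head b [] (i + length W) (Occ-++ʳ W [ b ] i o)

  readC : ℕ → ℕ → List ℕ
  readC p zero = []
  readC p (suc k) = circ X p ∷ readC (suc p) k

  length-readC : ∀ p k → length (readC p k) ≡ k
  length-readC p zero = refl
  length-readC p (suc k) = cong suc (length-readC (suc p) k)

  Occ-readC : ∀ p k → Occ (readC p k) p
  Occ-readC p (suc k) = Occ-cons _ _ p refl (Occ-readC (suc p) k)

  take-readC : ∀ p k' k → k' ≤ k → take k' (readC p k) ≡ readC p k'
  take-readC p zero k _ = refl
  take-readC p (suc k') (suc k) (s≤s l) = cong (_ ∷_) (take-readC (suc p) k' k l)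

  Occ⇒readC : ∀ W i → Occ W i → W ≡ readC i (length W)
  Occ⇒readC W i o = nth-ext W _ (sym (length-readC i (length W)))
     (λ j q → trans (o j q) (sym (Occ-readC i (length W) j (subst (j <_) (sym (length-readC i _)) q))))

  drop-inside : ∀ i j → i < n → j < length (drop i X) → i + j < n
  drop-inside i j i<n j< = subst (i + j <_) (m+[n∸m]≡n (<⇒≤ i<n)) (+-monoʳ-< i (subst (j <_) (length-drop i X) j<))

  drop-Occ : ∀ i → i < n → Occ (drop i X) i
  drop-Occ i i<n j j< = trans (nth-drop i X j) (sym (circ-lt (i + j) (drop-inside i j i<n j<)))

-- A circular occurrence of W in X is an ordinary factor of the power
-- X^(|W|+1); reversing the power gives a factor reverse W of (reverse X)^(|W|+1), which is
-- again a circular occurrence.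

pow : ℕ → List ℕ → List ℕ
pow zero X = []
pow (suc c) X = X ++ pow c X

length-pow : ∀ c (X : List ℕ) → length (pow c X) ≡ c * length X
length-pow zero X = refl
length-pow (suc c) X = trans (length-++ X) (cong (length X +_) (length-pow c X))

pow-snoc : ∀ c (X : List ℕ) → pow c X ++ X ≡ X ++ pow c X
pow-snoc zero X = sym (++-identityʳ X)
pow-snoc (suc c) X = trans (++-assoc X (pow c X) X) (cong (X ++_) (pow-snoc c X))

reverse-pow : ∀ c (X : List ℕ) → reverse (pow c X) ≡ pow c (reverse X)
reverse-pow zero X = refl
reverse-pow (suc c) X = begin
  reverse (X ++ pow c X)            ≡⟨ reverse-++ X (pow c X) ⟩
  reverse (pow c X) ++ reverse X    ≡⟨ cong (_++ reverse X) (reverse-pow c X) ⟩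
  pow c (reverse X) ++ reverse X    ≡⟨ pow-snoc c (reverse X) ⟩
  reverse X ++ pow c (reverse X)    ∎ where open ≡-Reasoning

factor-at : ∀ (Y W : List ℕ) i → i + length W ≤ length Y → (∀ j → j < length W → nth W j ≡ nth Y (i + j)) →
  Y ≡ take i Y ++ W ++ drop (i + length W) Y
factor-at Y W i le h = begin
  Y                                                      ≡⟨ take++drop≡id i Y ⟨
  take i Y ++ drop i Y                                   ≡⟨ cong (take i Y ++_) (take++drop≡id (length W) (drop i Y)) ⟨
  take i Y ++ take (length W) (drop i Y) ++ drop (length W) (drop i Y)
     ≡⟨ cong₂ (λ a b → take i Y ++ a ++ b) (sym W≡) (drop-drop i (length W) Y) ⟩
  take i Y ++ W ++ drop (i + length W) Y                 ∎ where
  open ≡-Reasoning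
  fits : length W ≤ length (drop i Y)
  fits = subst (length W ≤_) (sym (length-drop i Y)) (subst (_≤ length Y ∸ i) (m+n∸m≡n i (length W)) (∸-monoˡ-≤ i le))
  W≡ : W ≡ take (length W) (drop i Y)
  W≡ = nth-ext W _ (sym (length-take≤ (length W) (drop i Y) fits))
    (λ j q → trans (h j q) (trans (sym (nth-drop i Y j)) (sym (nth-take (length W) (drop i Y) j q))))

module _ (x : ℕ) (xs : List ℕ) where
  open Circular x xs

  circ-period : ∀ k → circ X (k + n) ≡ circ X k
  circ-period k = circ-mod (k + n) k ([m+n]%n≡m%n k n)

  nth-pow : ∀ c k → k < length (pow c X) → nth (pow c X) k ≡ circ X k
  nth-pow (suc c) k q with k <? n
  ... | yes k<n = trans (nth-++ˡ X _ k k<n) (sym (circ-lt k k<n))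
  ... | no k≮n = begin
     nth (X ++ pow c X) k          ≡⟨ cong (nth (X ++ pow c X)) e ⟨
     nth (X ++ pow c X) (n + k')   ≡⟨ nth-++ʳ X _ k' ⟩
     nth (pow c X) k'              ≡⟨ nth-pow c k' k'< ⟩
     circ X k'                     ≡⟨ circ-period k' ⟨
     circ X (k' + n)               ≡⟨ cong (circ X) (trans (+-comm k' n) e) ⟩
     circ X k                      ∎ where
       open ≡-Reasoning
       k' = k ∸ n
       e : n + k' ≡ k
       e = m+[n∸m]≡n (≮⇒≥ k≮n)
       k'< : k' < length (pow c X)
       k'< = +-cancelˡ-< n _ _ (subst₂ _<_ (sym e) (length-++ X) q)

  Occ⇒factor : ∀ W i → i < n → Occ W i → ∃ λ A → ∃ λ B → pow (suc (length W)) X ≡ A ++ W ++ B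
  Occ⇒factor W i i<n o = take i P , drop (i + length W) P , factor-at P W i fits agree where
    P = pow (suc (length W)) X
    fits : i + length W ≤ length P
    fits = subst (i + length W ≤_) (sym (length-pow (suc (length W)) X))
      (≤-trans (<⇒≤ (+-monoˡ-< (length W) i<n)) (+-monoʳ-≤ n (m≤m*n (length W) n)))
    agree : ∀ j → j < length W → nth W j ≡ nth P (i + j)
    agree j q = trans (o j q) (sym (nth-pow (suc (length W)) (i + j) (<-≤-trans (+-monoʳ-< i q) fits)))

  factor⇒Occ : ∀ c A W B → pow c X ≡ A ++ W ++ B → Occ W (length A)
  factor⇒Occ c A W B eq j q = begin
    nth W j                             ≡⟨ nth-++ˡ W B j q ⟨
    nth (W ++ B) j                      ≡⟨ nth-++ʳ A (W ++ B) j ⟨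
    nth (A ++ W ++ B) (length A + j)    ≡⟨ cong (λ z → nth z (length A + j)) eq ⟨
    nth (pow c X) (length A + j)        ≡⟨ nth-pow c (length A + j) inside ⟩
    circ X (length A + j)               ∎ where
    open ≡-Reasoning
    inside : length A + j < length (pow c X)
    inside = subst (length A + j <_) (sym (trans (cong length eq) (length-++ A)))
      (+-monoʳ-< (length A) (<-≤-trans q (subst (length W ≤_) (sym (length-++ W)) (m≤m+n _ _))))

occurs-reverse⇒ : ∀ x xs y ys → reverse (x ∷ xs) ≡ y ∷ ys → ∀ W →
  T (occurs (x ∷ xs) W) → T (occurs (y ∷ ys) (reverse W))
occurs-reverse⇒ x xs y ys rev W p with Circular.occurs⇒Occ x xs W p
... | i , i<n , o with Occ⇒factor x xs W i i<n o
... | A , B , eq = Circular.Occ⇒occurs y ys (reverse W) (length (reverse B))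
                     (factor⇒Occ y ys c (reverse B) (reverse W) (reverse A) eq') where
  c = suc (length W)
  eq' : pow c (y ∷ ys) ≡ reverse B ++ reverse W ++ reverse A
  eq' = begin
    pow c (y ∷ ys)                           ≡⟨ cong (pow c) rev ⟨
    pow c (reverse (x ∷ xs))                 ≡⟨ reverse-pow c (x ∷ xs) ⟨
    reverse (pow c (x ∷ xs))                 ≡⟨ cong reverse eq ⟩
    reverse (A ++ W ++ B)                    ≡⟨ reverse-++ A (W ++ B) ⟩
    reverse (W ++ B) ++ reverse A            ≡⟨ cong (_++ reverse A) (reverse-++ W B) ⟩
    (reverse B ++ reverse W) ++ reverse A    ≡⟨ ++-assoc (reverse B) (reverse W) (reverse A) ⟩
    reverse B ++ reverse W ++ reverse A      ∎ where open ≡-Reasoning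

occurs-reverse : ∀ x xs y ys → reverse (x ∷ xs) ≡ y ∷ ys → ∀ W → occurs (y ∷ ys) (reverse W) ≡ occurs (x ∷ xs) W
occurs-reverse x xs y ys rev W = T-ext
  (λ p → subst (λ z → T (occurs (x ∷ xs) z)) (reverse-involutive W) (occurs-reverse⇒ y ys x xs rev' (reverse W) p))
  (occurs-reverse⇒ x xs y ys rev W)
  where
  rev' : reverse (y ∷ ys) ≡ x ∷ xs
  rev' = trans (cong reverse (sym rev)) (reverse-involutive (x ∷ xs))

module Reversal (σ x : ℕ) (xs : List ℕ) (y : ℕ) (ys : List ℕ) (rev : reverse (x ∷ xs) ≡ y ∷ ys) where

  occurs-snoc : ∀ V a → occurs (y ∷ ys) (a ∷ reverse V) ≡ occurs (x ∷ xs) (V ++ [ a ])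
  occurs-snoc V a = trans (cong (occurs (y ∷ ys)) (sym (reverse-++ V [ a ]))) (occurs-reverse x xs y ys rev (V ++ [ a ]))

  rightMaximal-reverse : ∀ W → rightMaximal σ (y ∷ ys) (reverse W) ≡ leftMaximal σ (x ∷ xs) W
  rightMaximal-reverse W = cong (1 <ᵇ_)
    (count-cong (λ b → occurs (y ∷ ys) (reverse W ++ [ b ])) (λ a → occurs (x ∷ xs) (a ∷ W))
      (λ b → trans (cong (occurs (y ∷ ys)) (sym (reverse-++ [ b ] W))) (occurs-reverse x xs y ys rev (b ∷ W)))
      (upTo (suc σ)))

  rightMaximal-cons : ∀ V a → rightMaximal σ (y ∷ ys) (a ∷ reverse V) ≡ leftMaximal σ (x ∷ xs) (V ++ [ a ])
  rightMaximal-cons V a = trans (cong (rightMaximal σ (y ∷ ys)) (sym (reverse-++ V [ a ]))) (rightMaximal-reverse (V ++ [ a ]))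

record EndMarked (σ : ℕ) (X : List ℕ) : Set where
  field
    bounded : ∀ k → nth X k ≤ σ
    marker-last : ∀ k → suc k ≡ length X → nth X k ≡ 0
    marker-unique : ∀ k → k < length X → nth X k ≡ 0 → suc k ≡ length X

-- Repeats of an end-marked text: the unique # pins down occurrences, so a right-maximal
-- string cannot contain #, and neither can a left-maximal one.
module EndMarkedText (σ x : ℕ) (xs : List ℕ) (em : EndMarked σ (x ∷ xs)) where
  open Circular x xs public
  open EndMarked em

  RM : List ℕ → Bool
  RM = rightMaximal σ X

  LM : List ℕ → Bool
  LM = leftMaximal σ X

  circ-bounded : ∀ k → circ X k ≤ σ
  circ-bounded k = bounded (k % n)

  Occ-bounded : ∀ W i → Occ W i → ∀ j → j < length W → nth W j ≤ σ
  Occ-bounded W i o j q = subst (_≤ σ) (sym (o j q)) (circ-bounded (i + j))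

  rightMaximal⁻ : ∀ W → T (RM W) → ∃ λ b → ∃ λ b' → ¬ b ≡ b' × T (occurs X (W ++ [ b ])) × T (occurs X (W ++ [ b' ]))
  rightMaximal⁻ W = count-two⁻ (λ b → occurs X (W ++ [ b ])) (upTo (suc σ)) (UniqueP.upTo⁺ _)

  rightMaximal⁺ : ∀ W b b' → ¬ b ≡ b' → b ≤ σ → b' ≤ σ → T (occurs X (W ++ [ b ])) → T (occurs X (W ++ [ b' ])) → T (RM W)
  rightMaximal⁺ W b b' ne b≤ b'≤ =
    count-two (λ b → occurs X (W ++ [ b ])) (upTo (suc σ)) (∈-upTo⁺ (s≤s b≤)) (∈-upTo⁺ (s≤s b'≤)) ne

  leftMaximal⁻ : ∀ W → T (LM W) → ∃ λ a → ∃ λ a' → ¬ a ≡ a' × T (occurs X (a ∷ W)) × T (occurs X (a' ∷ W))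
  leftMaximal⁻ W = count-two⁻ (λ a → occurs X (a ∷ W)) (upTo (suc σ)) (UniqueP.upTo⁺ _)

  marker-aligns : ∀ W p q j → Occ W p → Occ W q → j < length W → nth W j ≡ 0 → p % n ≡ q % n
  marker-aligns W p q j op oq j< z = %-cancelˡ-+ m p q j (trans (at-marker p op) (sym (at-marker q oq))) where
    at-marker : ∀ r → Occ W r → (r + j) % n ≡ m
    at-marker r o = suc-injective (marker-unique ((r + j) % n) (m%n<n (r + j) n) (trans (sym (o j j<)) z))

  rightMaximal-no-marker : ∀ W → T (RM W) → ∀ j → j < length W → ¬ nth W j ≡ 0
  rightMaximal-no-marker W p j j< z with rightMaximal⁻ W p
  ... | b , b' , b≢b' , ob , ob' with occurs⇒Occ (W ++ [ b ]) ob | occurs⇒Occ (W ++ [ b' ]) ob'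
  ... | p1 , _ , o1 | p2 , _ , o2 = b≢b' (begin
      b                          ≡⟨ Occ-last W b p1 o1 ⟩
      circ X (p1 + length W)     ≡⟨ circ-mod (p1 + length W) (p2 + length W) (%-congˡ-+ n p1 p2 (length W) aligned) ⟩
      circ X (p2 + length W)     ≡⟨ Occ-last W b' p2 o2 ⟨
      b'                         ∎) where
    open ≡-Reasoning
    aligned : p1 % n ≡ p2 % n
    aligned = marker-aligns W p1 p2 j (Occ-++ˡ W [ b ] p1 o1) (Occ-++ˡ W [ b' ] p2 o2) j< z

  leftMaximal-no-marker : ∀ W j → j < length W → nth W j ≡ 0 → ¬ T (LM W)
  leftMaximal-no-marker W j j< z p with leftMaximal⁻ W p
  ... | a , a' , a≢a' , oa , oa' with occurs⇒Occ (a ∷ W) oa | occurs⇒Occ (a' ∷ W) oa'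
  ... | p1 , _ , o1 | p2 , _ , o2 = a≢a' (begin
      a          ≡⟨ Occ-head a W p1 o1 ⟩
      circ X p1  ≡⟨ circ-mod p1 p2 (%-cancelˡ-+ m p1 p2 1 (subst₂ (λ u v → u % n ≡ v % n) (+-comm 1 p1) (+-comm 1 p2) aligned)) ⟩
      circ X p2  ≡⟨ Occ-head a' W p2 o2 ⟨
      a'         ∎) where
    open ≡-Reasoning
    aligned : suc p1 % n ≡ suc p2 % n
    aligned = marker-aligns W (suc p1) (suc p2) j (Occ-tail a W p1 o1) (Occ-tail a' W p2 o2) j< z

  -- Two distinct right extensions of W occur at distinct positions, so W is a repeat.
  rightMaximal⇒repeat : ∀ W → T (RM W) → T (isRepeat X W)
  rightMaximal⇒repeat W p with rightMaximal⁻ W p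
  ... | b , b' , b≢b' , ob , ob' with occurs⇒Occ (W ++ [ b ]) ob | occurs⇒Occ (W ++ [ b' ]) ob'
  ... | p1 , p1< , o1 | p2 , p2< , o2 =
    count-two (matchAt X W) (upTo n) (∈-upTo⁺ p1<) (∈-upTo⁺ p2<) p1≢p2
      (Occ⇒match W p1 (Occ-++ˡ W [ b ] p1 o1)) (Occ⇒match W p2 (Occ-++ˡ W [ b' ] p2 o2)) where
    p1≢p2 : ¬ p1 ≡ p2
    p1≢p2 refl = b≢b' (trans (Occ-last W b p1 o1) (sym (Occ-last W b' p1 o2)))

  leaf⁻ : ∀ W → T (isLeaf X W) → ∃ λ i → i < n × W ≡ drop i X
  leaf⁻ W p with find (AnyP.any⁻ (λ i → eqStr W (drop i X)) (upTo n) p)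
  ... | i , i∈ , e = i , ∈-upTo⁻ i∈ , eqStr⁻ W (drop i X) e

  leaf-marker : ∀ i → i < n → (m ∸ i < length (drop i X)) × nth (drop i X) (m ∸ i) ≡ 0
  leaf-marker i (s≤s i≤m) =
    subst (m ∸ i <_) (sym (trans (length-drop i X) (+-∸-assoc 1 i≤m))) ≤-refl ,
    trans (nth-drop i X (m ∸ i)) (trans (cong (nth X) (m+[n∸m]≡n i≤m)) (marker-last m refl))

  leaf-marker-last : ∀ i → i < n → ∀ j → j < length (drop i X) → nth (drop i X) j ≡ 0 → suc j ≡ length (drop i X)
  leaf-marker-last i i<n j j< z = begin
      suc j               ≡⟨ m+n∸m≡n i (suc j) ⟨
      i + suc j ∸ i       ≡⟨ cong (_∸ i) (+-suc i j) ⟩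
      suc (i + j) ∸ i     ≡⟨ cong (λ u → suc u ∸ i) at-marker ⟩
      n ∸ i               ≡⟨ length-drop i X ⟨
      length (drop i X)   ∎ where
    open ≡-Reasoning
    at-marker : i + j ≡ m
    at-marker = suc-injective (marker-unique (i + j) (drop-inside i j i<n j<) (trans (sym (nth-drop i X j)) z))

  leaf-not-leftMaximal : ∀ i → i < n → ¬ T (LM (drop i X))
  leaf-not-leftMaximal i i<n =
    leftMaximal-no-marker (drop i X) (m ∸ i) (proj₁ (leaf-marker i i<n)) (proj₂ (leaf-marker i i<n))

  node-Occ : ∀ W → T (isNode σ X W) → ∃ λ i → Occ W i
  node-Occ W p with ∨-elim {RM W} p
  ... | inj₁ r with rightMaximal⁻ W r
  ...   | b , _ , _ , ob , _ with occurs⇒Occ (W ++ [ b ]) ob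
  ...     | i , _ , oi = i , Occ-++ˡ W [ b ] i oi
  node-Occ W p | inj₂ l with leaf⁻ W l
  ...   | i , i<n , refl = i , drop-Occ i i<n

  node-marker-last : ∀ W → T (isNode σ X W) → ∀ j → j < length W → nth W j ≡ 0 → suc j ≡ length W
  node-marker-last W p j j< z with ∨-elim {RM W} p
  ... | inj₁ r = ⊥-elim (rightMaximal-no-marker W r j j< z)
  ... | inj₂ l with leaf⁻ W l
  ...   | i , i<n , refl = leaf-marker-last i i<n j j< z

module SuffixTreeEdges (σ x : ℕ) (xs : List ℕ) (em : EndMarked σ (x ∷ xs)) where
  open EndMarkedText σ x xs em public
  open EndMarked em

  record Edge (V W : List ℕ) : Set where
    field
      internal : T (RM V)
      node : T (isNode σ X W)
      longer : length V < length W
      prefix : take (length V) W ≡ V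
      gap : ∀ k → length V < k → k < length W → ¬ T (RM (take k W))
  open Edge public

  edge⁻ : ∀ V W → T (isEdge σ X (V , W)) → Edge V W
  edge⁻ V W p = record
    { internal = ∧-fst p ; node = ∧-fst p₁ ; longer = <ᵇ⇒< _ _ (∧-fst p₃)
    ; prefix = eqStr⁻ _ _ (∧-snd {length V <ᵇ length W} p₃)
    ; gap = λ k V<k k<W r → not-elim (All.lookup (AllP.all⁺ gapf _ p₄) (∈-upTo⁺ k<W)) (∧-intro (<⇒<ᵇ V<k) r) }
    where
    gapf : ℕ → Bool
    gapf k = not ((length V <ᵇ k) ∧ isInternal σ X (take k W))
    p₁ = ∧-snd {RM V} p
    p₂ = ∧-snd {isNode σ X W} p₁
    p₃ = ∧-fst p₂
    p₄ = ∧-snd {properPrefix V W} p₂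

  edge⁺ : ∀ V W → Edge V W → T (isEdge σ X (V , W))
  edge⁺ V W e = ∧-intro (internal e) (∧-intro (node e) (∧-intro
    (∧-intro (<⇒<ᵇ (longer e)) (subst (λ z → T (eqStr (take (length V) W) z)) (prefix e) (eqStr-refl (take (length V) W))))
    (AllP.all⁻ _ (All.tabulate no-gap))))
    where
    no-gap : ∀ {k} → k ∈ upTo (length W) → T (not ((length V <ᵇ k) ∧ isInternal σ X (take k W)))
    no-gap {k} k∈ with T? (length V <ᵇ k)
    ... | no V≮k = not-intro (λ r → V≮k (∧-fst r))
    ... | yes V<k = not-intro (λ r → gap e k (<ᵇ⇒< _ _ V<k) (∈-upTo⁻ k∈) (∧-snd {length V <ᵇ k} r))

  -- A string that is not right-maximal has a single right extension, so every
  -- occurrence of it continues with that character.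
  forced-extension : ∀ U c p → ¬ T (RM U) → c ≤ σ → T (occurs X (U ++ [ c ])) → Occ U p → Occ (U ++ [ c ]) p
  forced-extension U c p ¬rm c≤ oc o with circ X (p + length U) ≟ c
  ... | yes d≡c = Occ-snoc U c p o (sym d≡c)
  ... | no d≢c = ⊥-elim (¬rm (rightMaximal⁺ U _ c d≢c (circ-bounded (p + length U)) c≤
                                 (Occ⇒occurs (U ++ [ _ ]) p (Occ-snoc U _ p o refl)) oc))

  module _ {V W : List ℕ} (e : Edge V W) where
    b : ℕ
    b = nth W (length V)

    prefix-b : take (suc (length V)) W ≡ V ++ [ b ]
    prefix-b = trans (take-suc-nth (length V) W (longer e)) (cong (_++ [ b ]) (prefix e))

    W-occurs : ∃ λ q → Occ W q
    W-occurs = node-Occ W (node e)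

    Vb-occurs : T (occurs X (V ++ [ b ]))
    Vb-occurs with W-occurs
    ... | q , oq = Occ⇒occurs (V ++ [ b ]) q (subst (λ z → Occ z q) prefix-b (Occ-take (suc (length V)) W q oq))

    -- Strictly inside the edge nothing branches, so a left extension of a prefix of W
    -- longer than V extends to all of W.
    extend-step : ∀ a p k → length V < k → k < length W → Occ (a ∷ take k W) p → Occ (a ∷ take (suc k) W) p
    extend-step a p k V<k k<W o with W-occurs
    ... | q , oq = Occ-cons a (take (suc k) W) p (Occ-head a _ p o)
      (subst (λ z → Occ z (suc p)) (sym (take-suc-nth k W k<W))
        (forced-extension (take k W) (nth W k) (suc p) (gap e k V<k k<W) (Occ-bounded W q oq k k<W)
          (prefix-next-occurs W q k oq k<W) (Occ-tail a (take k W) p o)))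

    extend-left : ∀ a p d k → k + d ≡ length W → length V < k → Occ (a ∷ take k W) p → Occ (a ∷ W) p
    extend-left a p zero k eq V<k o =
      subst (λ z → Occ (a ∷ z) p) (trans (cong (λ z → take z W) (trans (sym (+-identityʳ k)) eq)) (take-whole W)) o
    extend-left a p (suc d) k eq V<k o = extend-left a p d (suc k) (trans (sym (+-suc k d)) eq) (≤-trans V<k (n≤1+n k))
      (extend-step a p k V<k (subst (k <_) eq (m<m+n k (s≤s z≤n))) o)

    left-extension : ∀ a → occurs X (a ∷ W) ≡ occurs X (a ∷ (V ++ [ b ]))
    left-extension a = T-ext shorten lengthen where
      shorten : T (occurs X (a ∷ W)) → T (occurs X (a ∷ (V ++ [ b ])))
      shorten p with occurs⇒Occ (a ∷ W) p
      ... | i , _ , o = Occ⇒occurs _ i (subst (λ z → Occ (a ∷ z) i) prefix-b (Occ-take (suc (suc (length V))) (a ∷ W) i o))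
      lengthen : T (occurs X (a ∷ (V ++ [ b ]))) → T (occurs X (a ∷ W))
      lengthen p with occurs⇒Occ (a ∷ (V ++ [ b ])) p
      ... | i , _ , o = Occ⇒occurs (a ∷ W) i (extend-left a i (length W ∸ suc (length V)) (suc (length V)) (m+[n∸m]≡n (longer e)) ≤-refl
                          (subst (λ z → Occ (a ∷ z) i) (sym prefix-b) o))

    leftMaximal-child : LM W ≡ LM (V ++ [ b ])
    leftMaximal-child = cong (1 <ᵇ_) (count-cong _ _ left-extension (upTo (suc σ)))

    -- The endpoint W is a maximal repeat iff V·b is left-maximal: an internal W is a
    -- repeat, and a leaf W contains # and is not left-maximal.
    maximal-child : maximalRepeat σ X W ≡ LM (V ++ [ b ])
    maximal-child = T-ext to from where
      to : T (maximalRepeat σ X W) → T (LM (V ++ [ b ]))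
      to p = subst T leftMaximal-child (∧-fst (∧-snd {isRepeat X W} p))
      from : T (LM (V ++ [ b ])) → T (maximalRepeat σ X W)
      from p with ∨-elim {RM W} (node e)
      ... | inj₁ r = ∧-intro (rightMaximal⇒repeat W r) (∧-intro (subst T (sym leftMaximal-child) p) r)
      ... | inj₂ l with leaf⁻ W l
      ...   | i , i<n , refl = ⊥-elim (leaf-not-leftMaximal i i<n (subst T (sym leftMaximal-child) p))

  -- An occurrence of a right-maximal V, which avoids #, ends before the # of X.
  rightMaximal-within : ∀ V p → T (RM V) → p < n → Occ V p → p + length V < n
  rightMaximal-within V p rm p<n o with p + length V <? n
  ... | yes fits = fits
  ... | no ¬fits = ⊥-elim (rightMaximal-no-marker V rm (m ∸ p) j< (trans (o (m ∸ p) j<) at-marker)) where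
    p≤m : p ≤ m
    p≤m = s≤s⁻¹ p<n
    j< : m ∸ p < length V
    j< = subst (m ∸ p <_) (m+n∸m≡n p (length V)) (∸-monoˡ-< (≮⇒≥ ¬fits) p≤m)
    at-marker : circ X (p + (m ∸ p)) ≡ 0
    at-marker = trans (cong (circ X) (m+[n∸m]≡n p≤m)) (trans (circ-lt m ≤-refl) (marker-last m refl))

  suffix-node : ∀ p → p < n → T (isNode σ X (readC p (n ∸ p)))
  suffix-node p p<n = ∨-inr {RM (readC p (n ∸ p))} (AnyP.any⁺ _ (lose (∈-upTo⁺ p<n)
    (subst (λ z → T (eqStr (readC p (n ∸ p)) z)) (sym suffix≡) (eqStr-refl (readC p (n ∸ p))))))
    where
    suffix≡ : drop p X ≡ readC p (n ∸ p)
    suffix≡ = trans (Occ⇒readC (drop p X) p (drop-Occ p p<n)) (cong (readC p) (length-drop p X))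

  -- Existence of children: if V is internal and V·a occurs, then following an occurrence
  -- of V·a down to the first node gives an edge (V, W) whose label starts with a.
  child : ∀ V a → T (RM V) → T (occurs X (V ++ [ a ])) → ∃ λ W → Edge V W × nth W (length V) ≡ a
  child V a rm oc with occurs⇒Occ (V ++ [ a ]) oc
  ... | p , p<n , o with least (λ k → isNode σ X (readC p k)) (n ∸ p ∸ suc (length V)) (suc (length V))
                             (subst (λ k → T (isNode σ X (readC p k))) (sym (m+[n∸m]≡n reaches-leaf)) (suffix-node p p<n))
    where
    reaches-leaf : suc (length V) ≤ n ∸ p
    reaches-leaf = subst (_≤ n ∸ p) (m+n∸m≡n p (suc (length V)))
      (∸-monoˡ-≤ p (subst (_≤ n) (sym (+-suc p (length V))) (rightMaximal-within V p rm p<n (Occ-++ˡ V [ a ] p o))))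
  ... | k , V<k , nodeK , first = readC p k , edge , starts-with-a where
    len : length (readC p k) ≡ k
    len = length-readC p k
    edge : Edge V (readC p k)
    edge = record
      { internal = rm ; node = nodeK ; longer = subst (length V <_) (sym len) V<k
      ; prefix = trans (take-readC p (length V) k (≤-trans (n≤1+n _) V<k)) (sym (Occ⇒readC V p (Occ-++ˡ V [ a ] p o)))
      ; gap = λ k' V<k' k'< r → first k' V<k' (subst (k' <_) len k'<)
                (∨-inl (subst (λ z → T (RM z)) (take-readC p k' k (<⇒≤ (subst (k' <_) len k'<))) r)) }
    starts-with-a : nth (readC p k) (length V) ≡ a
    starts-with-a = trans (Occ-readC p k (length V) (subst (length V <_) (sym len) V<k)) (sym (Occ-last V a p o))

  -- A node W below V can not be a proper prefix of another
  -- child W' of V: an internal W would break the edge (V, W'), and a leaf W ends with #,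
  -- which in W' can only be the last character.
  no-nested-children : ∀ V W W' → Edge V W → Edge V W' → W ≡ take (length W) W' → ¬ length W < length W'
  no-nested-children V W W' e e' W≡ W<W' with ∨-elim {RM W} (node e)
  ... | inj₁ r = gap e' (length W) (longer e) W<W' (subst (λ z → T (RM z)) W≡ r)
  ... | inj₂ l with leaf⁻ W l
  ...   | i , i<n , refl = <-irrefl refl (≤-<-trans (subst (_≤ length W) last (proj₁ (leaf-marker i i<n))) W<W') where
    j = m ∸ i
    j< = proj₁ (leaf-marker i i<n)
    marker-in-W' : nth W' j ≡ 0
    marker-in-W' = trans (sym (nth-take (length (drop i X)) W' j j<))
                     (trans (cong (λ z → nth z j) (sym W≡)) (proj₂ (leaf-marker i i<n)))
    last : suc j ≡ length W'
    last = node-marker-last W' (node e') j (<-≤-trans j< (<⇒≤ W<W')) marker-in-W'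

  prefix-sibling : ∀ V W W' → Edge V W → Edge V W' → take (length W) W ≡ take (length W) W' → length W ≤ length W' → W ≡ W'
  prefix-sibling V W W' e e' eq W≤W' with m≤n⇒m<n∨m≡n W≤W'
  ... | inj₁ W<W' = ⊥-elim (no-nested-children V W W' e e' (trans (sym (take-whole W)) eq) W<W')
  ... | inj₂ same = trans (sym (take-whole W)) (trans eq (trans (cong (λ z → take z W') same) (take-whole W')))

  -- Children starting with the same character coincide; otherwise their longest common
  -- prefix would be a right-maximal string strictly inside the edge.
  child-unique : ∀ V W W' → Edge V W → Edge V W' → nth W (length V) ≡ nth W' (length V) → W ≡ W'
  child-unique V W W' e e' same-b with lcp W W'
  ... | k , eq , inj₁ (refl , W≤W') = prefix-sibling V W W' e e' eq W≤W'
  ... | k , eq , inj₂ (inj₁ (refl , W'≤W)) = sym (prefix-sibling V W' W e' e (sym eq) W'≤W)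
  ... | k , eq , inj₂ (inj₂ (k<W , k<W' , differ)) = ⊥-elim (gap e k V<k k<W branching) where
    agree-past-V : take (suc (length V)) W ≡ take (suc (length V)) W'
    agree-past-V = trans (prefix-b e) (trans (cong (λ c → V ++ [ c ]) same-b) (sym (prefix-b e')))
    V<k : length V < k
    V<k with length V <? k
    ... | yes V<k = V<k
    ... | no V≮k = ⊥-elim (differ (trans (sym (nth-take (suc (length V)) W k k≤V))
                     (trans (cong (λ z → nth z k) agree-past-V) (nth-take (suc (length V)) W' k k≤V)))) where
      k≤V : k < suc (length V)
      k≤V = s≤s (≮⇒≥ V≮k)
    branching : T (RM (take k W))
    branching with W-occurs e | W-occurs e'
    ... | q , oq | q' , oq' = rightMaximal⁺ (take k W) (nth W k) (nth W' k) differ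
          (Occ-bounded W q oq k k<W) (Occ-bounded W' q' oq' k k<W')
          (prefix-next-occurs W q k oq k<W)
          (subst (λ z → T (occurs X (z ++ [ nth W' k ]))) (sym eq) (prefix-next-occurs W' q' k oq' k<W'))

-- The two sides of the theorem, filtered by a Boolean function f: f = id gives ℰ^r and
-- the explicit links, f = not gives ℱ^r and the implicit links (definitionally).

edge-condition : ℕ → String → (Bool → Bool) → String × String → Bool
edge-condition σ X f e = isEdge σ X e ∧ maximalRepeat σ X (proj₁ e) ∧ f (maximalRepeat σ X (proj₂ e))

link-condition : ℕ → String → String → (Bool → Bool) → String × ℕ → Bool
link-condition σ X Y f l =
  (isWeinerLink σ Y l ∧ f (isInternal σ Y (proj₂ l ∷ proj₁ l))) ∧ maximalRepeat σ X (reverse (proj₁ l))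

MaximalEdges : ℕ → String → (Bool → Bool) → Set
MaximalEdges σ X f = Σ (String × String) (λ e → T (edge-condition σ X f e))

WeinerLinks : ℕ → String → String → (Bool → Bool) → Set
WeinerLinks σ X Y f = Σ (String × ℕ) (λ l → T (link-condition σ X Y f l))

module Correspondence (σ x : ℕ) (xs : List ℕ) (y : ℕ) (ys : List ℕ) (rev : reverse (x ∷ xs) ≡ y ∷ ys)
  (em : EndMarked σ (x ∷ xs)) (f : Bool → Bool) where
  open SuffixTreeEdges σ x xs em
  open Reversal σ x xs y ys rev

  Y : List ℕ
  Y = y ∷ ys

  MR : List ℕ → Bool
  MR = maximalRepeat σ X

  -- The link labelled b from reverse V is explicit iff V·b is left-maximal, i.e. iff the
  -- endpoint of the edge is a maximal repeat.
  explicit≡maximal : ∀ {V W} (e : Edge V W) → isInternal σ Y (b e ∷ reverse V) ≡ MR W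
  explicit≡maximal {V} e = trans (rightMaximal-cons V (b e)) (sym (maximal-child e))

  link⇒child : ∀ V a → T (link-condition σ X Y f (reverse V , a)) →
    ∃ λ W → Σ (Edge V W) λ e → b e ≡ a × T (edge-condition σ X f (V , W))
  link⇒child V a q = from-child (child V a (∧-snd {LM V} (∧-snd {isRepeat X V} maximalV)) extension-occurs) where
    maximalV : T (MR V)
    maximalV = subst (λ z → T (MR z)) (reverse-involutive V) (∧-snd {isWeinerLink σ Y (reverse V , a) ∧ _} q)
    extension-occurs : T (occurs X (V ++ [ a ]))
    extension-occurs = subst T (occurs-snoc V a) (∧-snd {rightMaximal σ Y (reverse V)} (∧-fst (∧-fst q)))
    from-child : (∃ λ W → Edge V W × nth W (length V) ≡ a) →
      ∃ λ W → Σ (Edge V W) λ e → b e ≡ a × T (edge-condition σ X f (V , W))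
    from-child (W , e , b≡a) = W , e , b≡a , ∧-intro (edge⁺ V W e) (∧-intro maximalV maximalW) where
      maximalW : T (f (MR W))
      maximalW = subst (λ z → T (f z))
        (trans (cong (λ c → isInternal σ Y (c ∷ reverse V)) (sym b≡a)) (explicit≡maximal e))
        (∧-snd {isWeinerLink σ Y (reverse V , a)} (∧-fst q))

  to-link : MaximalEdges σ X f → WeinerLinks σ X Y f
  to-link ((V , W) , p) = (reverse V , b e) , ∧-intro (∧-intro link explicit) maximal where
    e = edge⁻ V W (∧-fst p)
    mV = ∧-fst (∧-snd {isEdge σ X (V , W)} p)
    link : T (isWeinerLink σ Y (reverse V , b e))
    link = ∧-intro (subst T (sym (rightMaximal-reverse V)) (∧-fst (∧-snd {isRepeat X V} mV)))
                   (subst T (sym (occurs-snoc V (b e))) (Vb-occurs e))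
    explicit : T (f (isInternal σ Y (b e ∷ reverse V)))
    explicit = subst (λ z → T (f z)) (sym (explicit≡maximal e)) (∧-snd {MR V} (∧-snd {isEdge σ X (V , W)} p))
    maximal : T (MR (reverse (reverse V)))
    maximal = subst (λ z → T (MR z)) (sym (reverse-involutive V)) mV

  -- Injective: V is recovered by reversal and W is the unique child starting with b.
  to-link-injective : ∀ {u v} → to-link u ≡ to-link v → u ≡ v
  to-link-injective {(V , W) , p} {(V' , W') , p'} eq =
    refine-≡ (edge-condition σ X f) (cong₂ _,_ V≡V' W≡W') where
    V≡V' : V ≡ V'
    V≡V' = reverse-injective (cong (λ z → proj₁ (proj₁ z)) eq)
    same-label : nth W (length V) ≡ nth W' (length V')
    same-label = cong (λ z → proj₂ (proj₁ z)) eq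
    same-source : V ≡ V' → Edge V W → Edge V' W' → W ≡ W'
    same-source refl e e' = child-unique V W W' e e' same-label
    W≡W' : W ≡ W'
    W≡W' = same-source V≡V' (edge⁻ V W (∧-fst p)) (edge⁻ V' W' (∧-fst p'))

  to-link-surjective : ∀ l → ∃ λ u → ∀ {z} → z ≡ u → to-link z ≡ l
  to-link-surjective ((V' , a) , q) = from-child (link⇒child (reverse V') a q') where
    q' : T (link-condition σ X Y f (reverse (reverse V') , a))
    q' = subst (λ z → T (link-condition σ X Y f (z , a))) (sym (reverse-involutive V')) q
    from-child : (∃ λ W → Σ (Edge (reverse V') W) λ e → b e ≡ a × T (edge-condition σ X f (reverse V' , W))) →
      ∃ λ u → ∀ {z} → z ≡ u → to-link z ≡ ((V' , a) , q)
    from-child (W , e , b≡a , p) = u , λ z≡u → trans (cong to-link z≡u) image where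
      u : MaximalEdges σ X f
      u = (reverse V' , W) , p
      image : to-link u ≡ ((V' , a) , q)
      image = refine-≡ (link-condition σ X Y f) (cong₂ _,_ (reverse-involutive V') b≡a)

  bijection : MaximalEdges σ X f ⤖ WeinerLinks σ X Y f
  bijection = mk⤖ (to-link-injective , to-link-surjective)

endMarked : ∀ σ s → All (λ c → 1 ≤ c × c ≤ σ) s → EndMarked σ (s ++ [ 0 ])
endMarked σ s letters =
  record { bounded = bounded s letters ; marker-last = last s ; marker-unique = unique s letters }
  where
  length-snoc : ∀ (s : List ℕ) → length (s ++ [ 0 ]) ≡ suc (length s)
  length-snoc s = trans (length-++ s) (+-comm (length s) 1)
  bounded : ∀ s → All (λ c → 1 ≤ c × c ≤ σ) s → ∀ k → nth (s ++ [ 0 ]) k ≤ σ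
  bounded [] _ zero = z≤n
  bounded [] _ (suc k) = z≤n
  bounded (c ∷ s) (c∈ ∷ _) zero = proj₂ c∈
  bounded (c ∷ s) (_ ∷ s∈) (suc k) = bounded s s∈ k
  last : ∀ s k → suc k ≡ length (s ++ [ 0 ]) → nth (s ++ [ 0 ]) k ≡ 0
  last [] zero _ = refl
  last (c ∷ s) zero eq = ⊥-elim (1+n≢0 (sym (suc-injective (trans eq (cong suc (length-snoc s))))))
  last (c ∷ s) (suc k) eq = last s k (suc-injective eq)
  unique : ∀ s → All (λ c → 1 ≤ c × c ≤ σ) s →
    ∀ k → k < length (s ++ [ 0 ]) → nth (s ++ [ 0 ]) k ≡ 0 → suc k ≡ length (s ++ [ 0 ])
  unique [] _ zero _ _ = refl
  unique [] _ (suc k) (s≤s ()) _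
  unique (c ∷ s) (c∈ ∷ _) zero _ z = ⊥-elim (<-irrefl (sym z) (proj₁ c∈))
  unique (c ∷ s) (_ ∷ s∈) (suc k) (s≤s k<) z = cong suc (unique s s∈ k k< z)

reverse-nonempty : ∀ x (xs : List ℕ) → ∃ λ y → ∃ λ ys → reverse (x ∷ xs) ≡ y ∷ ys
reverse-nonempty x xs with reverse xs | unfold-reverse x xs
... | [] | eq = x , [] , eq
... | z ∷ zs | eq = z , zs ++ [ x ] , eq

edges≅links : ∀ σ x xs → EndMarked σ (x ∷ xs) → ∀ f →
  MaximalEdges σ (x ∷ xs) f ⤖ WeinerLinks σ (x ∷ xs) (reverse (x ∷ xs)) f
edges≅links σ x xs em f with y , ys , rev ← reverse-nonempty x xs =
  subst (λ Y → MaximalEdges σ (x ∷ xs) f ⤖ WeinerLinks σ (x ∷ xs) Y f) (sym rev)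
        (Correspondence.bijection σ x xs y ys rev em f)

bijections : ∀ σ x xs → EndMarked σ (x ∷ xs) →
  (Er σ (x ∷ xs) ⤖ ExplWLrev σ (x ∷ xs)) × (Fr σ (x ∷ xs) ⤖ ImplWLrev σ (x ∷ xs))
bijections σ x xs em = edges≅links σ x xs em id , edges≅links σ x xs em not

lemma1 : (σ : ℕ) (s : List ℕ) → All (λ c → 1 ≤ c × c ≤ σ) s →
    (Er σ (s ++ [ 0 ]) ⤖ ExplWLrev σ (s ++ [ 0 ])) × (Fr σ (s ++ [ 0 ]) ⤖ ImplWLrev σ (s ++ [ 0 ]))
lemma1 σ [] letters = bijections σ 0 [] (endMarked σ [] letters)
lemma1 σ (c ∷ s) letters = bijections σ c (s ++ [ 0 ]) (endMarked σ (c ∷ s) letters)
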